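{- Let $\Gamma$ be a simple non-complete graph with vertex set $\{v_1,\dots,v_n\}$. Suppose $\Gamma$ has exactly one dominating vertex $v_1$ and $\deg(v_i)=d$ for all $i\in\{2,\dots,n\}$, where $1\leq d\leq n-2$. Then there exists a non-zero $(0,1)$-vector in the row space of the adjacency matrix $A(\Gamma)$ over $\mathbb{R}$ which does not occur as a row of $A(\Gamma)$.
   Context: A dominating vertex is a vertex adjacent to every other vertex. The adjacency matrix $A(\Gamma)=(a_{ij})$ has $a_{ij}=1$ if $v_i$ is adjacent to $v_j$ and $0$ otherwise; the row space is over the real numbers. -}

module Defs where

open import Data.Nat using (ℕ; zero; suc; _+_)
open import Data.Bool using (Bool; true; false; if_then_else_)
open import Data.Fin using (Fin; zero; suc)
open import Data.Rational using (ℚ; 0ℚ; 1ℚ) renaming (_+_ to _+ℚ_)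
open import Data.Product using (Σ; ∃; _×_; _,_)
open import Relation.Binary.PropositionalEquality using (_≡_; _≢_)
open import Relation.Nullary using (¬_)

record SimpleGraph (n : ℕ) : Set where
  field
    adj       : Fin n → Fin n → Bool
    symmetric : ∀ i j → adj i j ≡ adj j i
    loopless  : ∀ i → adj i i ≡ false
open SimpleGraph public

sumℕ : ∀ {n} → (Fin n → ℕ) → ℕ
sumℕ {zero}  f = 0
sumℕ {suc n} f = f zero + sumℕ (λ i → f (suc i))

sumℚ : ∀ {n} → (Fin n → ℚ) → ℚ
sumℚ {zero}  f = 0ℚ
sumℚ {suc n} f = f zero +ℚ sumℚ (λ i → f (suc i))

boolToℕ : Bool → ℕ
boolToℕ b = if b then 1 else 0

boolToℚ : Bool → ℚ
boolToℚ b = if b then 1ℚ else 0ℚ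

degree : ∀ {n} → SimpleGraph n → Fin n → ℕ
degree G i = sumℕ (λ j → boolToℕ (adj G i j))

IsComplete : ∀ {n} → SimpleGraph n → Set
IsComplete G = ∀ i j → i ≢ j → adj G i j ≡ true

IsDominating : ∀ {n} → SimpleGraph n → Fin n → Set
IsDominating G v = ∀ j → v ≢ j → adj G v j ≡ true

adjMatrix : ∀ {n} → SimpleGraph n → Fin n → Fin n → ℚ
adjMatrix G i j = boolToℚ (adj G i j)

InRowSpace : ∀ {n} → (Fin n → Fin n → ℚ) → (Fin n → ℚ) → Set
InRowSpace {n} M x = Σ (Fin n → ℚ) λ c → ∀ j → sumℚ (λ i → c i Data.Rational.* M i j) ≡ x j

IsRowOf : ∀ {n} → SimpleGraph n → (Fin n → Bool) → Set
IsRowOf {n} G x = Σ (Fin n) λ i → ∀ j → adj G i j ≡ x j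

{-# OPTIONS --safe #-}
-- The all-ones vector is the witness. It is not a row, since A(Γ) has zero diagonal.
-- It is a combination of rows: column v₁ contains n − 1 ones below the diagonal and
-- every other column v_k contains a one in row v₁ and d − 1 further ones, so with
-- weight a on row v₁ and weight 1/(n − 1) on every other row each column sums to 1
-- once a = 1 − (d − 1)/(n − 1).
module Submission where

open import Defs
open import Data.Nat using (ℕ; zero; suc; _≤_; _∸_; z≤n; s≤s)
open import Data.Bool using (Bool; true; false)
open import Data.Fin using (Fin; zero; suc)
open import Data.Vec.Functional using (_∷_)
open import Data.Product using (Σ; _×_; _,_)
open import Function using (const; _∘_)
open import Relation.Binary.PropositionalEquality using (_≡_; _≢_; refl; sym; trans; cong; cong₂)
open import Relation.Nullary using (¬_)
import Data.Nat as ℕ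
open import Data.Rational using (ℚ; 0ℚ; 1ℚ; _+_; _*_; _-_; 1/_; NonNegative; NonZero)
open import Data.Rational.Properties
open import Algebra.Properties.Group +-0-group using (//-rightDividesˡ)
open Relation.Binary.PropositionalEquality.≡-Reasoning

ℕ→ℚ : ℕ → ℚ
ℕ→ℚ zero    = 0ℚ
ℕ→ℚ (suc k) = 1ℚ + ℕ→ℚ k

ℕ→ℚ-nonNeg : ∀ k → NonNegative (ℕ→ℚ k)
ℕ→ℚ-nonNeg zero    = _
ℕ→ℚ-nonNeg (suc k) = nonNeg+nonNeg⇒nonNeg 1ℚ (ℕ→ℚ k) {{ℕ→ℚ-nonNeg k}}

ℕ→ℚ-suc-nonZero : ∀ k → NonZero (ℕ→ℚ (suc k))
ℕ→ℚ-suc-nonZero k = pos⇒nonZero (ℕ→ℚ (suc k)) {{pos+nonNeg⇒pos 1ℚ (ℕ→ℚ k) {{ℕ→ℚ-nonNeg k}}}}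

ℕ→ℚ-boolToℕ-+ : ∀ b s → ℕ→ℚ (boolToℕ b ℕ.+ s) ≡ boolToℚ b + ℕ→ℚ s
ℕ→ℚ-boolToℕ-+ true  s = refl
ℕ→ℚ-boolToℕ-+ false s = sym (+-identityˡ (ℕ→ℚ s))

sumℕ-cong : ∀ {n} {f g : Fin n → ℕ} → (∀ i → f i ≡ g i) → sumℕ f ≡ sumℕ g
sumℕ-cong {zero}  f≗g = refl
sumℕ-cong {suc n} f≗g = cong₂ ℕ._+_ (f≗g zero) (sumℕ-cong (f≗g ∘ suc))

sumℕ-const-1 : ∀ n → sumℕ {n} (const 1) ≡ n
sumℕ-const-1 zero    = refl
sumℕ-const-1 (suc n) = cong suc (sumℕ-const-1 n)

sumℚ-*-boolToℚ : ∀ {n} q (f : Fin n → Bool) →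
  sumℚ (λ i → q * boolToℚ (f i)) ≡ q * ℕ→ℚ (sumℕ (boolToℕ ∘ f))
sumℚ-*-boolToℚ {zero}  q f = sym (*-zeroʳ q)
sumℚ-*-boolToℚ {suc n} q f = begin
  q * boolToℚ (f zero) + sumℚ (λ i → q * boolToℚ (f (suc i)))
    ≡⟨ cong (q * boolToℚ (f zero) +_) (sumℚ-*-boolToℚ q (f ∘ suc)) ⟩
  q * boolToℚ (f zero) + q * ℕ→ℚ s
    ≡⟨ *-distribˡ-+ q (boolToℚ (f zero)) (ℕ→ℚ s) ⟨
  q * (boolToℚ (f zero) + ℕ→ℚ s)
    ≡⟨ cong (q *_) (ℕ→ℚ-boolToℕ-+ (f zero) s) ⟨
  q * ℕ→ℚ (boolToℕ (f zero) ℕ.+ s) ∎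
  where s = sumℕ (boolToℕ ∘ f ∘ suc)

allTrue-notRowOf : ∀ {n} (G : SimpleGraph n) → ¬ IsRowOf G (const true)
allTrue-notRowOf G (i , row≡) with trans (sym (loopless G i)) (row≡ i)
... | ()

tailDegree : ∀ {m} → SimpleGraph (suc m) → Fin (suc m) → ℕ
tailDegree G j = sumℕ (λ i → boolToℕ (adj G (suc i) j))

module _ {m} (G : SimpleGraph (suc m)) (dom : IsDominating G zero) where

  adj-suc-zero : ∀ i → adj G (suc i) zero ≡ true
  adj-suc-zero i = trans (symmetric G (suc i) zero) (dom (suc i) λ ())

  tailDegree-zero : tailDegree G zero ≡ m
  tailDegree-zero = trans (sumℕ-cong (cong boolToℕ ∘ adj-suc-zero)) (sumℕ-const-1 m)

  degree-suc : ∀ k → degree G (suc k) ≡ suc (tailDegree G (suc k))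
  degree-suc k = cong₂ ℕ._+_ (cong boolToℕ (adj-suc-zero k))
                             (sumℕ-cong λ i → cong boolToℕ (symmetric G (suc k) (suc i)))

column-sum : ∀ {m} (G : SimpleGraph (suc m)) a q j →
  sumℚ (λ i → (a ∷ const q) i * adjMatrix G i j)
    ≡ a * adjMatrix G zero j + q * ℕ→ℚ (tailDegree G j)
column-sum G a q j = cong (a * adjMatrix G zero j +_) (sumℚ-*-boolToℚ q (λ i → adj G (suc i) j))

allOnes-inRowSpace : ∀ {m} d (G : SimpleGraph (suc (suc m))) → IsDominating G zero →
  (∀ i → i ≢ zero → degree G i ≡ d) → InRowSpace (adjMatrix G) (const 1ℚ)
allOnes-inRowSpace {m} d G dom deg = a ∷ const q , column≡1
  where
  instance
    m+1≢0 : NonZero (ℕ→ℚ (suc m))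
    m+1≢0 = ℕ→ℚ-suc-nonZero m

  q = 1/ ℕ→ℚ (suc m)
  a = 1ℚ - q * ℕ→ℚ (d ∸ 1)

  column≡1 : ∀ j → sumℚ (λ i → (a ∷ const q) i * adjMatrix G i j) ≡ 1ℚ
  column≡1 zero = begin
    sumℚ (λ i → (a ∷ const q) i * adjMatrix G i zero)
      ≡⟨ column-sum G a q zero ⟩
    a * boolToℚ (adj G zero zero) + q * ℕ→ℚ (tailDegree G zero)
      ≡⟨ cong₂ (λ b t → a * boolToℚ b + q * ℕ→ℚ t) (loopless G zero) (tailDegree-zero G dom) ⟩
    a * 0ℚ + q * ℕ→ℚ (suc m)
      ≡⟨ cong (_+ q * ℕ→ℚ (suc m)) (*-zeroʳ a) ⟩
    0ℚ + q * ℕ→ℚ (suc m)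
      ≡⟨ trans (+-identityˡ _) (*-inverseˡ (ℕ→ℚ (suc m))) ⟩
    1ℚ ∎
  column≡1 (suc k) = begin
    sumℚ (λ i → (a ∷ const q) i * adjMatrix G i (suc k))
      ≡⟨ column-sum G a q (suc k) ⟩
    a * boolToℚ (adj G zero (suc k)) + q * ℕ→ℚ (tailDegree G (suc k))
      ≡⟨ cong₂ (λ b t → a * boolToℚ b + q * ℕ→ℚ t) (dom (suc k) λ ()) tailDegree≡d∸1 ⟩
    a * 1ℚ + q * ℕ→ℚ (d ∸ 1)
      ≡⟨ cong (_+ q * ℕ→ℚ (d ∸ 1)) (*-identityʳ a) ⟩
    a + q * ℕ→ℚ (d ∸ 1)
      ≡⟨ //-rightDividesˡ (q * ℕ→ℚ (d ∸ 1)) 1ℚ ⟩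
    1ℚ ∎
    where
    tailDegree≡d∸1 : tailDegree G (suc k) ≡ d ∸ 1
    tailDegree≡d∸1 = cong (_∸ 1) (trans (sym (degree-suc G dom k)) (deg (suc k) λ ()))

lemma4p8 : (m d : ℕ) (G : SimpleGraph (suc m)) →
    ¬ IsComplete G →
    IsDominating G zero →
    (∀ v → IsDominating G v → v ≡ zero) →
    (∀ i → i ≢ zero → degree G i ≡ d) →
    1 ≤ d → d ≤ suc m ∸ 2 →
    Σ (Fin (suc m) → Bool) λ x →
      Σ (Fin (suc m)) (λ j → x j ≡ true) ×
      InRowSpace (adjMatrix G) (λ j → boolToℚ (x j)) ×
      ¬ IsRowOf G x
lemma4p8 zero    d G _ _   _ _   (s≤s z≤n) ()
lemma4p8 (suc m) d G _ dom _ deg _         _  =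
  const true , (zero , refl) , allOnes-inRowSpace d G dom deg , allTrue-notRowOf G
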